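{- Let $(S,+,\cdot)$ be a semiring and let $(R,\cdot)$ be a subsemigroup of $(S,\cdot)$ such that $R$ is an $\mathrm{IP}_0$ set in $(S,+)$. If $A \subseteq R$ is piecewise syndetic in $(R,\cdot)$, then $A$ is an $\mathrm{IP}_0$ set in $(S,+)$.
   Context: A semiring $(S,+,\cdot)$ is a set with two binary operations such that $(S,+)$ is a commutative semigroup, $(S,\cdot)$ is a semigroup (not necessarily commutative), and both distributive laws hold. For $B \subseteq S$: $B$ is an $\mathrm{IP}_r$ set in $(S,+)$ if there exist $s_1,\dots,s_r \in S$ such that $\sum_{i\in\alpha} s_i \in B$ for every nonempty $\alpha \subseteq \{1,\dots,r\}$; $B$ is an $\mathrm{IP}_0$ set if it is an $\mathrm{IP}_r$ set for every $r \in \mathbb{N}$. For $r \in R$ and $B \subseteq R$, let $r^{ -1}B = \{t \in R : rt \in B\}$. A set $B \subseteq R$ is thick in $(R,\cdot)$ if for every finite $F \subseteq R$ there is $x \in R$ with $Fx \subseteq B$, and piecewise syndetic in $(R,\cdot)$ if there exist $r_1,\dots,r_k \in R$ such that $r_1^{ -1}B \cup \dots \cup r_k^{ -1}B$ is thick in $(R,\cdot)$. -}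

module Defs where

open import Level using (Level; _⊔_)
open import Data.Nat using (ℕ; zero)
import Data.Nat as ℕ
open import Data.Fin using (Fin; zero)
import Data.Fin as Fin
open import Data.Fin.Subset using (Subset; Nonempty)
open import Data.Vec using (_∷_; [])
open import Data.Bool using (Bool; true; false)
open import Data.Maybe using (Maybe; just; nothing)
open import Data.List using (List)
open import Data.List.Relation.Unary.All using (All)
open import Data.List.Relation.Unary.Any using (Any)
open import Data.Product using (Σ; ∃; _×_)
open import Relation.Unary using (Pred; _∈_; _⊆_)
open import Relation.Binary.PropositionalEquality using (_≡_)
open import Algebra.Core using (Op₂)
open import Algebra.Structures using (IsCommutativeSemigroup; IsSemigroup)
open import Algebra.Definitions using (_DistributesOverˡ_; _DistributesOverʳ_)

-- A semiring in the sense of the paper: no additive or multiplicative identity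
-- is required; (S,+) commutative semigroup, (S,·) semigroup, both distributive laws.
record Semiring (c : Level) : Set (Level.suc c) where
  infixl 6 _+_
  infixl 7 _·_
  field
    Carrier : Set c
    _+_ : Op₂ Carrier
    _·_ : Op₂ Carrier
    +-isCommutativeSemigroup : IsCommutativeSemigroup _≡_ _+_
    ·-isSemigroup : IsSemigroup _≡_ _·_
    distribˡ : _DistributesOverˡ_ _≡_ _·_ _+_
    distribʳ : _DistributesOverʳ_ _≡_ _·_ _+_

module _ {c : Level} (𝕊 : Semiring c) where
  open Semiring 𝕊

  _+?_ : Maybe Carrier → Maybe Carrier → Maybe Carrier
  nothing +? m = m
  just x +? nothing = just x
  just x +? just y = just (x + y)

  -- sumOver s α = just (Σ_{i ∈ α} s i) if α is nonempty, nothing if α is empty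
  sumOver : ∀ {r : ℕ} → (Fin r → Carrier) → Subset r → Maybe Carrier
  sumOver {zero} s [] = nothing
  sumOver {ℕ.suc r} s (true ∷ α) = just (s zero) +? sumOver (λ i → s (Fin.suc i)) α
  sumOver {ℕ.suc r} s (false ∷ α) = sumOver (λ i → s (Fin.suc i)) α

  IP : ∀ {ℓ} → ℕ → Pred Carrier ℓ → Set (c ⊔ ℓ)
  IP r B = Σ (Fin r → Carrier) λ s →
             (α : Subset r) → Nonempty α →
             ∃ λ x → sumOver s α ≡ just x × x ∈ B

  IP₀ : ∀ {ℓ} → Pred Carrier ℓ → Set (c ⊔ ℓ)
  IP₀ B = (r : ℕ) → IP r B

  IsSubsemigroup : ∀ {ℓ} → Pred Carrier ℓ → Set (c ⊔ ℓ)
  IsSubsemigroup R = ∀ {x y} → x ∈ R → y ∈ R → (x · y) ∈ R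

  -- Below, R is the ambient subsemigroup; subsets of R are predicates B with B ⊆ R.
  module _ {ℓ} (R : Pred Carrier ℓ) where

    preimage : ∀ {ℓ'} → Carrier → Pred Carrier ℓ' → Pred Carrier (ℓ ⊔ ℓ')
    preimage r B t = t ∈ R × (r · t) ∈ B

    Thick : ∀ {ℓ'} → Pred Carrier ℓ' → Set (c ⊔ ℓ ⊔ ℓ')
    Thick B = (F : List Carrier) → All (_∈ R) F →
              ∃ λ x → x ∈ R × All (λ f → (f · x) ∈ B) F

    PiecewiseSyndetic : ∀ {ℓ'} → Pred Carrier ℓ' → Set (c ⊔ ℓ ⊔ ℓ')
    PiecewiseSyndetic B = ∃ λ (rs : List Carrier) → All (_∈ R) rs ×
      Thick (λ t → Any (λ r → preimage r B t) rs)

-- Take generators t of an IP_n set in R, for n large. Thickness of r₁⁻¹A ∪ … ∪ r_k⁻¹A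
-- gives a single w such that every finite sum y = Σ_{i∈α} tᵢ has rⱼ · (y · w) ∈ A for
-- some j; colour α by such a j. Folkman's theorem (finite unions form) yields disjoint
-- nonempty blocks D₁, …, D_r all of whose nonempty unions receive one colour j, and then
-- sᵢ = rⱼ · ((Σ_{l∈Dᵢ} t_l) · w) generates an IP_r set in A, because y ↦ rⱼ · (y · w) is
-- additive.
--
-- Folkman's theorem follows by induction on a budget of blocks per colour from a cube
-- lemma: every colouring of the subsets of a large enough finite set admits a nonempty C
-- and disjoint nonempty blocks D₁, …, D_m such that C ∪ ⋃_{j∈β} Dⱼ has the same colour for
-- every β, including β = ∅. The cube's C becomes a new block for its colour, and the
-- induction hypothesis is applied to the colouring induced on unions of the Dⱼ.

module Submission where

open import Defs
open import Level using (Level)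
open import Relation.Unary using (Pred; _⊆_)
open import Algebra.Structures using (IsCommutativeSemigroup)
open import Data.Nat using (ℕ; zero; suc; _+_; _^_; _≤_; _<_; z≤n; s≤s; pred; +-0-rawMonoid)
import Data.Nat.Properties as ℕ
open import Algebra.Definitions.RawMonoid +-0-rawMonoid using (sum)
open import Data.Fin using (Fin; zero; suc; toℕ; _↑ˡ_; _↑ʳ_; funToFin; finToFun)
import Data.Fin.Properties as Fin
open import Data.Fin.Subset using (Subset; ⊥; ⊤; _∪_; Nonempty; inside; outside; _∈_)
  renaming (_⊆_ to _⊆ₛ_)
open import Data.Fin.Subset.Properties
  using (x∈p∪q⁻; x∈p∪q⁺; ∉⊥; ∈⊤; ⊆-antisym; ∪-identityˡ; ∪-identityʳ; ∪-idem)
open import Data.Vec using (Vec; []; _∷_; _++_; lookup; tabulate; here; there)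
import Data.Vec.Properties as Vec
open import Data.Vec.Functional using (updateAt)
open import Data.Vec.Functional.Properties using (updateAt-updates; updateAt-minimal)
open import Data.Bool using (_∨_)
open import Data.Maybe using (Maybe; just; nothing)
import Data.Maybe as Maybe
open import Data.Maybe.Properties using (just-injective)
open import Data.Maybe.Relation.Unary.All as MaybeAll using (just; nothing)
open import Data.List as List using (List; length; mapMaybe)
open import Data.List.Membership.Propositional using () renaming (_∈_ to _∈ₗ_)
import Data.List.Membership.Propositional.Properties as List
open import Data.List.Relation.Unary.All as All using (All)
import Data.List.Relation.Unary.All.Properties as All
open import Data.List.Relation.Unary.Any as Any using (Any)
open import Data.List.Relation.Unary.Any.Properties using (lookup-index)
open import Data.Product using (∃; _×_; _,_; proj₁; proj₂)
open import Data.Sum using (inj₁; inj₂)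
open import Data.Empty as Empty using (⊥-elim)
open import Function using (_∘_; id)
open import Relation.Nullary using (yes; no)
open import Relation.Binary.PropositionalEquality
  using (_≡_; _≢_; refl; sym; trans; cong; cong₂; subst; module ≡-Reasoning)

-- Blocks and their unions

Disjoint : ∀ {n} → Subset n → Subset n → Set
Disjoint p q = ∀ {x} → x ∈ p → x ∈ q → Empty.⊥

unionOf : ∀ {m n} → (Fin m → Subset n) → Subset m → Subset n
unionOf D []            = ⊥
unionOf D (outside ∷ β) = unionOf (D ∘ suc) β
unionOf D (inside ∷ β)  = D zero ∪ unionOf (D ∘ suc) β

∈-unionOf⁻ : ∀ {m n} (D : Fin m → Subset n) β {x} → x ∈ unionOf D β → ∃ λ j → j ∈ β × x ∈ D j
∈-unionOf⁻ D [] x∈ = ⊥-elim (∉⊥ x∈)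
∈-unionOf⁻ D (outside ∷ β) x∈ with ∈-unionOf⁻ (D ∘ suc) β x∈
... | j , j∈β , x∈Dj = suc j , there j∈β , x∈Dj
∈-unionOf⁻ D (inside ∷ β) x∈ with x∈p∪q⁻ (D zero) _ x∈
... | inj₁ x∈D₀ = zero , here , x∈D₀
... | inj₂ x∈U with ∈-unionOf⁻ (D ∘ suc) β x∈U
...   | j , j∈β , x∈Dj = suc j , there j∈β , x∈Dj

∈-unionOf⁺ : ∀ {m n} (D : Fin m → Subset n) β {x j} → j ∈ β → x ∈ D j → x ∈ unionOf D β
∈-unionOf⁺ D (inside ∷ β)  here       x∈ = x∈p∪q⁺ (inj₁ x∈)
∈-unionOf⁺ D (outside ∷ β) (there j∈) x∈ = ∈-unionOf⁺ (D ∘ suc) β j∈ x∈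
∈-unionOf⁺ D (inside ∷ β)  (there j∈) x∈ = x∈p∪q⁺ (inj₂ (∈-unionOf⁺ (D ∘ suc) β j∈ x∈))

unionOf-unionOf : ∀ {l m n} (D : Fin m → Subset n) (Γ : Fin l → Subset m) β →
                  unionOf (unionOf D ∘ Γ) β ≡ unionOf D (unionOf Γ β)
unionOf-unionOf D Γ β = ⊆-antisym sub sup
  where
  sub : unionOf (unionOf D ∘ Γ) β ⊆ₛ unionOf D (unionOf Γ β)
  sub x∈ with ∈-unionOf⁻ (unionOf D ∘ Γ) β x∈
  ... | j , j∈β , x∈Γj with ∈-unionOf⁻ D (Γ j) x∈Γj
  ...   | i , i∈Γj , x∈Di = ∈-unionOf⁺ D _ (∈-unionOf⁺ Γ β j∈β i∈Γj) x∈Di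
  sup : unionOf D (unionOf Γ β) ⊆ₛ unionOf (unionOf D ∘ Γ) β
  sup x∈ with ∈-unionOf⁻ D (unionOf Γ β) x∈
  ... | i , i∈U , x∈Di with ∈-unionOf⁻ Γ β i∈U
  ...   | j , j∈β , i∈Γj = ∈-unionOf⁺ (unionOf D ∘ Γ) β j∈β (∈-unionOf⁺ D (Γ j) i∈Γj x∈Di)

record Blocks (m n : ℕ) : Set where
  field
    block    : Fin m → Subset n
    nonempty : ∀ j → Nonempty (block j)
    disjoint : ∀ {i j} → i ≢ j → Disjoint (block i) (block j)

  union : Subset m → Subset n
  union = unionOf block

  union-nonempty : ∀ {β} → Nonempty β → Nonempty (union β)
  union-nonempty {β} (j , j∈β) = proj₁ (nonempty j) , ∈-unionOf⁺ block β j∈β (proj₂ (nonempty j))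

  union-disjoint : ∀ {α β} → Disjoint α β → Disjoint (union α) (union β)
  union-disjoint {α} {β} α#β x∈α x∈β with ∈-unionOf⁻ block α x∈α | ∈-unionOf⁻ block β x∈β
  ... | i , i∈α , x∈Di | j , j∈β , x∈Dj with i Fin.≟ j
  ...   | yes refl = α#β i∈α j∈β
  ...   | no i≢j   = disjoint i≢j x∈Di x∈Dj

open Blocks using (block; nonempty; disjoint; union; union-nonempty; union-disjoint)

coarsen : ∀ {l m n} → Blocks m n → Blocks l m → Blocks l n
coarsen D Γ = record
  { block    = union D ∘ block Γ
  ; nonempty = union-nonempty D ∘ nonempty Γ
  ; disjoint = union-disjoint D ∘ disjoint Γ
  }

cons : ∀ {m n} (C : Subset n) → Nonempty C → (D : Blocks m n) →
       (∀ j → Disjoint C (Blocks.block D j)) → Blocks (suc m) n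
cons C C≠∅ D C#D = record
  { block    = λ { zero → C ; (suc j) → block D j }
  ; nonempty = λ { zero → C≠∅ ; (suc j) → nonempty D j }
  ; disjoint = λ { {zero} {zero} 0≢0 → ⊥-elim (0≢0 refl)
                 ; {zero} {suc j} _ → C#D j
                 ; {suc i} {zero} _ x∈Di x∈C → C#D i x∈C x∈Di
                 ; {suc i} {suc j} i≢j → disjoint D (i≢j ∘ cong suc) }
  }

noBlocks : ∀ {n} → Blocks 0 n
noBlocks = record { block = λ () ; nonempty = λ () ; disjoint = λ { {()} } }

∪-++ : ∀ {g h} (p : Subset g) (q : Subset h) p′ q′ → (p ++ q) ∪ (p′ ++ q′) ≡ (p ∪ p′) ++ (q ∪ q′)
∪-++ = Vec.zipWith-++ _∨_

⊥++⊥ : ∀ g {h} → ⊥ {g} ++ ⊥ {h} ≡ ⊥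
⊥++⊥ zero    = refl
⊥++⊥ (suc g) = cong (outside ∷_) (⊥++⊥ g)

∈-++⁺ˡ : ∀ {g h} {p : Subset g} {q : Subset h} {x} → x ∈ p → x ↑ˡ h ∈ p ++ q
∈-++⁺ˡ here      = here
∈-++⁺ˡ (there x∈) = there (∈-++⁺ˡ x∈)

∈-++⁺ʳ : ∀ {g h} (p : Subset g) {q : Subset h} {y} → y ∈ q → g ↑ʳ y ∈ p ++ q
∈-++⁺ʳ []      y∈ = y∈
∈-++⁺ʳ (_ ∷ p) y∈ = there (∈-++⁺ʳ p y∈)

Disjoint-++ : ∀ {g h} {p p′ : Subset g} {q q′ : Subset h} →
              Disjoint p p′ → Disjoint q q′ → Disjoint (p ++ q) (p′ ++ q′)
Disjoint-++ {p = []}    {[]}     p#p′ q#q′ x∈ x∈′               = q#q′ x∈ x∈′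
Disjoint-++ {p = _ ∷ _} {_ ∷ _}  p#p′ q#q′ here       here       = p#p′ here here
Disjoint-++ {p = _ ∷ _} {_ ∷ _}  p#p′ q#q′ (there x∈) (there x∈′) =
  Disjoint-++ (λ y∈ y∈′ → p#p′ (there y∈) (there y∈′)) q#q′ x∈ x∈′

⊥-Disjointˡ : ∀ {n} {q : Subset n} → Disjoint ⊥ q
⊥-Disjointˡ x∈⊥ _ = ∉⊥ x∈⊥

⊥-Disjointʳ : ∀ {n} {p : Subset n} → Disjoint p ⊥
⊥-Disjointʳ _ x∈⊥ = ∉⊥ x∈⊥

unionOf-++⊥ : ∀ {m g h} (D : Fin m → Subset g) β → unionOf (λ j → D j ++ ⊥ {h}) β ≡ unionOf D β ++ ⊥
unionOf-++⊥ {g = g} D []            = sym (⊥++⊥ g)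
unionOf-++⊥         D (outside ∷ β) = unionOf-++⊥ (D ∘ suc) β
unionOf-++⊥         D (inside ∷ β)  = begin
  (D zero ++ ⊥) ∪ unionOf (λ j → D (suc j) ++ ⊥) β ≡⟨ cong ((D zero ++ ⊥) ∪_) (unionOf-++⊥ (D ∘ suc) β) ⟩
  (D zero ++ ⊥) ∪ (U ++ ⊥)                          ≡⟨ ∪-++ (D zero) ⊥ U ⊥ ⟩
  (D zero ∪ U) ++ (⊥ ∪ ⊥)                           ≡⟨ cong ((D zero ∪ U) ++_) (∪-idem ⊥) ⟩
  (D zero ∪ U) ++ ⊥                                 ∎
  where
  open ≡-Reasoning
  U = unionOf (D ∘ suc) β

padRight : ∀ {m g} h → Blocks m g → Blocks m (g + h)
padRight h D = record
  { block    = λ j → block D j ++ ⊥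
  ; nonempty = λ j → proj₁ (nonempty D j) ↑ˡ h , ∈-++⁺ˡ (proj₂ (nonempty D j))
  ; disjoint = λ i≢j → Disjoint-++ (disjoint D i≢j) ⊥-Disjointˡ
  }

-- interval h a b is {i < h : a ≤ i < b}
interval : ∀ h → ℕ → ℕ → Subset h
interval zero    _       _       = []
interval (suc h) _       zero    = ⊥
interval (suc h) zero    (suc b) = inside ∷ interval h zero b
interval (suc h) (suc a) (suc b) = outside ∷ interval h a b

interval-∪ : ∀ h {a b} → a ≤ b → interval h 0 a ∪ interval h a b ≡ interval h 0 b
interval-∪ zero    _         = refl
interval-∪ (suc h) z≤n       = ∪-identityˡ _
interval-∪ (suc h) (s≤s a≤b) = cong (inside ∷_) (interval-∪ h a≤b)

interval-Disjoint : ∀ h a b → Disjoint (interval h 0 a) (interval h a b)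
interval-Disjoint (suc h) zero    _       x∈ _           = ∉⊥ x∈
interval-Disjoint (suc h) (suc a) zero    _  x∈′         = ∉⊥ x∈′
interval-Disjoint (suc h) (suc a) (suc b) (there x∈) (there x∈′) = interval-Disjoint h a b x∈ x∈′

interval-nonempty : ∀ h {a b} → a < b → b ≤ h → Nonempty (interval h a b)
interval-nonempty (suc h) {zero}  {suc b} _         _         = zero , here
interval-nonempty (suc h) {suc a} {suc b} (s≤s a<b) (s≤s b≤h) =
  let x , x∈ = interval-nonempty h a<b b≤h in suc x , there x∈

-- The cube lemma

Colouring : ℕ → ℕ → Set
Colouring k n = Subset n → Fin k

record Cube {k n} (χ : Colouring k n) (m : ℕ) : Set where
  field
    base          : Subset n
    base-nonempty : Nonempty base
    blocks        : Blocks m n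
    base-disjoint : ∀ j → Disjoint base (block blocks j)
    colour        : Fin k
    constant      : ∀ β → χ (base ∪ union blocks β) ≡ colour

module _ {k : ℕ} where

  colourTable : ∀ n → Colouring k n → Vec (Fin k) (2 ^ n)
  colourTable zero    χ = χ [] ∷ []
  colourTable (suc n) χ = colourTable n (χ ∘ (inside ∷_)) ++ colourTable n (χ ∘ (outside ∷_)) ++ []

  colourTable-injective : ∀ n (χ ψ : Colouring k n) → colourTable n χ ≡ colourTable n ψ → ∀ X → χ X ≡ ψ X
  colourTable-injective zero    χ ψ eq []            = Vec.∷-injectiveˡ eq
  colourTable-injective (suc n) χ ψ eq (inside ∷ X)  =
    colourTable-injective n _ _ (Vec.++-injectiveˡ (colourTable n (χ ∘ (inside ∷_))) _ eq) X
  colourTable-injective (suc n) χ ψ eq (outside ∷ X) =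
    colourTable-injective n (χ ∘ (outside ∷_)) (ψ ∘ (outside ∷_))
      (Vec.++-injectiveˡ _ _ (Vec.++-injectiveʳ (colourTable n (χ ∘ (inside ∷_)))
                                                 (colourTable n (ψ ∘ (inside ∷_))) eq)) X

  encode : ∀ {n} → Colouring k n → Fin (k ^ 2 ^ n)
  encode {n} χ = funToFin (lookup (colourTable n χ))

  encode-injective : ∀ {n} (χ ψ : Colouring k n) → encode χ ≡ encode ψ → ∀ X → χ X ≡ ψ X
  encode-injective {n} χ ψ eq = colourTable-injective n χ ψ (begin
    colourTable n χ                    ≡⟨ Vec.tabulate∘lookup _ ⟨
    tabulate (lookup (colourTable n χ)) ≡⟨ Vec.tabulate-cong lookups ⟩
    tabulate (lookup (colourTable n ψ)) ≡⟨ Vec.tabulate∘lookup _ ⟩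
    colourTable n ψ                    ∎)
    where
    open ≡-Reasoning
    lookups : ∀ i → lookup (colourTable n χ) i ≡ lookup (colourTable n ψ) i
    lookups i = trans (sym (Fin.finToFun-funToFin _ i)) (trans (cong (λ c → finToFun c i) eq) (Fin.finToFun-funToFin _ i))

  cube-step : ∀ {m N L} (χ : Colouring k (N + L)) {a b} → a < b → b ≤ L →
              (∀ X → χ (X ++ interval L 0 a) ≡ χ (X ++ interval L 0 b)) →
              Cube (λ X → χ (X ++ interval L 0 a)) m → Cube χ (suc m)
  cube-step {m} {N} {L} χ {a} {b} a<b b≤L agree c = record
    { base          = C ++ I a
    ; base-nonempty = proj₁ (base-nonempty c) ↑ˡ L , ∈-++⁺ˡ (proj₂ (base-nonempty c))
    ; blocks        = cons (⊥ ++ Iab) (N ↑ʳ proj₁ Iab≠∅ , ∈-++⁺ʳ ⊥ (proj₂ Iab≠∅)) D′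
                           (λ j → Disjoint-++ {p′ = block D j} ⊥-Disjointˡ ⊥-Disjointʳ)
    ; base-disjoint = λ { zero    → Disjoint-++ ⊥-Disjointʳ (interval-Disjoint L a b)
                        ; (suc j) → Disjoint-++ (base-disjoint c j) ⊥-Disjointʳ }
    ; colour        = colour c
    ; constant      = λ { (outside ∷ β) → constant-outside β ; (inside ∷ β) → constant-inside β }
    }
    where
    open Cube
    open ≡-Reasoning
    I : ℕ → Subset L
    I = interval L 0
    Iab = interval L a b
    Iab≠∅ = interval-nonempty L a<b b≤L
    C = base c
    D = blocks c
    D′ = padRight L D
    U : Subset m → Subset N
    U = union D

    constant-outside : ∀ β → χ ((C ++ I a) ∪ union D′ β) ≡ colour c
    constant-outside β = begin
      χ ((C ++ I a) ∪ union D′ β)     ≡⟨ cong (λ Z → χ ((C ++ I a) ∪ Z)) (unionOf-++⊥ (block D) β) ⟩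
      χ ((C ++ I a) ∪ (U β ++ ⊥))     ≡⟨ cong χ (∪-++ C (I a) (U β) ⊥) ⟩
      χ ((C ∪ U β) ++ (I a ∪ ⊥))      ≡⟨ cong (λ Z → χ ((C ∪ U β) ++ Z)) (∪-identityʳ (I a)) ⟩
      χ ((C ∪ U β) ++ I a)            ≡⟨ constant c β ⟩
      colour c                        ∎

    constant-inside : ∀ β → χ ((C ++ I a) ∪ ((⊥ ++ Iab) ∪ union D′ β)) ≡ colour c
    constant-inside β = begin
      χ ((C ++ I a) ∪ ((⊥ ++ Iab) ∪ union D′ β))
        ≡⟨ cong (λ Z → χ ((C ++ I a) ∪ ((⊥ ++ Iab) ∪ Z))) (unionOf-++⊥ (block D) β) ⟩
      χ ((C ++ I a) ∪ ((⊥ ++ Iab) ∪ (U β ++ ⊥)))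
        ≡⟨ cong (λ Z → χ ((C ++ I a) ∪ Z)) (∪-++ ⊥ Iab (U β) ⊥) ⟩
      χ ((C ++ I a) ∪ ((⊥ ∪ U β) ++ (Iab ∪ ⊥)))
        ≡⟨ cong χ (∪-++ C (I a) (⊥ ∪ U β) (Iab ∪ ⊥)) ⟩
      χ ((C ∪ (⊥ ∪ U β)) ++ (I a ∪ (Iab ∪ ⊥)))
        ≡⟨ cong₂ (λ Y Z → χ ((C ∪ Y) ++ (I a ∪ Z))) (∪-identityˡ (U β)) (∪-identityʳ Iab) ⟩
      χ ((C ∪ U β) ++ (I a ∪ Iab))
        ≡⟨ cong (λ Z → χ ((C ∪ U β) ++ Z)) (interval-∪ L (ℕ.<⇒≤ a<b)) ⟩
      χ ((C ∪ U β) ++ I b)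
        ≡⟨ agree (C ∪ U β) ⟨
      χ ((C ∪ U β) ++ I a)
        ≡⟨ constant c β ⟩
      colour c ∎

  -- A pigeonhole over the k ^ 2 ^ N colourings of Subset N finds a < b for
  -- which appending the initial segment [0, a) or [0, b) induces the same colouring.
  cube : ∀ m → ∃ λ N → ∀ (χ : Colouring k N) → Cube χ m
  cube zero = 1 , λ χ → record
    { base          = ⊤
    ; base-nonempty = zero , ∈⊤
    ; blocks        = noBlocks
    ; base-disjoint = λ ()
    ; colour        = χ (⊤ ∪ ⊥)
    ; constant      = λ { [] → refl }
    }
  cube (suc m) = N + L , λ χ →
    let i , j , i<j , same = Fin.pigeonhole (ℕ.n<1+n L) (encode ∘ restrict χ ∘ toℕ)
    in cube-step χ i<j (Fin.toℕ≤pred[n] j) (encode-injective _ _ same) (cubeN (restrict χ (toℕ i)))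
    where
    N = proj₁ (cube m)
    cubeN = proj₂ (cube m)
    L = k ^ 2 ^ N
    restrict : Colouring k (N + L) → ℕ → Colouring k N
    restrict χ a X = χ (X ++ interval L 0 a)

-- Folkman's theorem

sum-updateAt-pred : ∀ {k} (a : Fin k → ℕ) c {p} → a c ≡ suc p → sum a ≡ suc (sum (updateAt a c pred))
sum-updateAt-pred a zero    ac≡1+p rewrite ac≡1+p = refl
sum-updateAt-pred a (suc c) ac≡1+p =
  trans (cong (a zero +_) (sum-updateAt-pred (a ∘ suc) c ac≡1+p)) (ℕ.+-suc (a zero) _)

≤-sum : ∀ {k} (a : Fin k → ℕ) c → a c ≤ sum a
≤-sum a zero    = ℕ.m≤m+n (a zero) _
≤-sum a (suc c) = ℕ.≤-trans (≤-sum (a ∘ suc) c) (ℕ.m≤n+m _ (a zero))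

record MonochromaticUnions {k n} (χ : Colouring k n) (c : Fin k) (m : ℕ) : Set where
  field
    blocks        : Blocks m n
    monochromatic : ∀ {β} → Nonempty β → χ (union blocks β) ≡ c

open MonochromaticUnions

module _ {k n} {χ : Colouring k n} where

  noUnions : ∀ {c} → MonochromaticUnions χ c 0
  noUnions = record { blocks = noBlocks ; monochromatic = λ { {[]} (() , _) } }

  pullback : ∀ {c m M} (D : Blocks M n) → MonochromaticUnions (χ ∘ union D) c m → MonochromaticUnions χ c m
  pullback D U = record
    { blocks        = coarsen D (blocks U)
    ; monochromatic = λ {β} β≠∅ → trans (cong χ (unionOf-unionOf (block D) (block (blocks U)) β))
                                        (monochromatic U β≠∅)
    }

  extend : ∀ {m M} (C : Cube χ M) → MonochromaticUnions (χ ∘ union (Cube.blocks C)) (Cube.colour C) m →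
           MonochromaticUnions χ (Cube.colour C) (suc m)
  extend C U = record
    { blocks        = cons base base-nonempty (blocks U′) base-disjoint′
    ; monochromatic = λ { {inside ∷ β}  _                   → base∪-constant β
                        ; {outside ∷ β} (suc j , there j∈β) → monochromatic U′ (j , j∈β) }
    }
    where
    open Cube C using (base; base-nonempty; base-disjoint; constant)
    D = Cube.blocks C
    U′ = pullback D U
    base∪-constant : ∀ β → χ (base ∪ union (blocks U′) β) ≡ Cube.colour C
    base∪-constant β = trans (cong (λ Z → χ (base ∪ Z)) (unionOf-unionOf (block D) (block (blocks U)) β))
                             (constant (union (blocks U) β))
    base-disjoint′ : ∀ j → Disjoint base (block (blocks U′) j)
    base-disjoint′ j x∈C x∈U with ∈-unionOf⁻ (block D) (block (blocks U) j) x∈U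
    ... | i , _ , x∈Di = base-disjoint i x∈C x∈Di

padUnions : ∀ {k n e c m} {χ : Colouring k (n + e)} →
            MonochromaticUnions (χ ∘ (_++ ⊥)) c m → MonochromaticUnions χ c m
padUnions {e = e} {χ = χ} U = record
  { blocks        = padRight e (blocks U)
  ; monochromatic = λ {β} β≠∅ → trans (cong χ (unionOf-++⊥ (block (blocks U)) β)) (monochromatic U β≠∅)
  }

module _ {k : ℕ} where

  Folkman : (Fin k → ℕ) → ℕ → Set
  Folkman a n = ∀ (χ : Colouring k n) → ∃ λ c → MonochromaticUnions χ c (a c)

  Folkman-≤ : ∀ {a n n′} → n ≤ n′ → Folkman a n → Folkman a n′
  Folkman-≤ {a} {n} n≤n′ F = subst (Folkman a) (ℕ.m+[n∸m]≡n n≤n′) λ χ →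
    let c , U = F (χ ∘ (_++ ⊥)) in c , padUnions U

  folkman-step : ∀ {n M} {a : Fin k → ℕ} (χ : Colouring k n) (C : Cube χ M) →
                 (∀ {p} → a (Cube.colour C) ≡ suc p → Folkman (updateAt a (Cube.colour C) pred) M) →
                 ∃ λ c → MonochromaticUnions χ c (a c)
  folkman-step {a = a} χ C lower with a (Cube.colour C) in eq
  ... | zero  = Cube.colour C , subst (MonochromaticUnions χ _) (sym eq) noUnions
  ... | suc p with lower refl (χ ∘ union (Cube.blocks C))
  ...   | c , U with c Fin.≟ Cube.colour C
  ...     | yes refl = c , subst (MonochromaticUnions χ c) 1+lowered≡ac (extend C U)
    where 1+lowered≡ac = trans (cong suc (trans (updateAt-updates c a) (cong pred eq))) (sym eq)
  ...     | no c≢colour = c , subst (MonochromaticUnions χ c) (updateAt-minimal c _ a c≢colour)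
                                    (pullback (Cube.blocks C) U)

  folkman-budget : ∀ N (a : Fin k → ℕ) → sum a ≡ N → ∃ (Folkman a)
  folkman-budget zero a Σa≡0 = 0 , λ χ →
    χ ⊥ , subst (MonochromaticUnions χ (χ ⊥))
                (sym (ℕ.n≤0⇒n≡0 (ℕ.≤-trans (≤-sum a (χ ⊥)) (ℕ.≤-reflexive Σa≡0)))) noUnions
  folkman-budget (suc N) a Σa≡1+N = proj₁ (cube M) , λ χ →
    let C = proj₂ (cube M) χ
        c = Cube.colour C
    in folkman-step χ C λ ac≡1+p → Folkman-≤ (≤-sum (proj₁ ∘ lowered) c) (proj₂ (lowered c) ac≡1+p)
    where
    lowered : ∀ c → ∃ λ n → ∀ {p} → a c ≡ suc p → Folkman (updateAt a c pred) n
    lowered c with a c in eq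
    ... | zero  = 0 , λ ()
    ... | suc p =
      let n , F = folkman-budget N (updateAt a c pred)
                                 (ℕ.suc-injective (trans (sym (sum-updateAt-pred a c eq)) Σa≡1+N))
      in n , λ { refl → F }
    M = sum (proj₁ ∘ lowered)

  folkman : ∀ m → ∃ λ n → ∀ (χ : Colouring k n) → ∃ λ c → MonochromaticUnions χ c m
  folkman m = folkman-budget _ (λ _ → m) refl

-- Finite sums in a semiring

allSubsets : ∀ n → List (Subset n)
allSubsets zero    = List.[ [] ]
allSubsets (suc n) = List.map (inside ∷_) (allSubsets n) List.++ List.map (outside ∷_) (allSubsets n)

∈-allSubsets : ∀ {n} (α : Subset n) → α ∈ₗ allSubsets n
∈-allSubsets []            = Any.here refl
∈-allSubsets (inside ∷ α)  = List.∈-++⁺ˡ (List.∈-map⁺ (inside ∷_) (∈-allSubsets α))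
∈-allSubsets (outside ∷ α) = List.∈-++⁺ʳ _ (List.∈-map⁺ (outside ∷_) (∈-allSubsets α))

All-mapMaybe⁻ : ∀ {a b p} {A : Set a} {B : Set b} {P : Pred B p} {f : A → Maybe B} xs →
                All P (mapMaybe f xs) → All (MaybeAll.All P ∘ f) xs
All-mapMaybe⁻         List.[]       All.[] = All.[]
All-mapMaybe⁻ {P = P} {f} (x List.∷ xs) pxs with f x in fx≡
... | nothing = subst (MaybeAll.All P) (sym fx≡) nothing All.∷ All-mapMaybe⁻ xs pxs
... | just _  = subst (MaybeAll.All P) (sym fx≡) (just (All.head pxs)) All.∷ All-mapMaybe⁻ xs (All.tail pxs)

module _ {a p} {A : Set a} {P : A → A → Set p} {rs : List A} where

  colourOf : ∀ {m} → MaybeAll.All (λ y → Any (λ r → P r y) rs) m → Fin (suc (length rs))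
  colourOf nothing  = zero
  colourOf (just q) = suc (Any.index q)

  colourOf-just : ∀ {m y} (q : MaybeAll.All (λ y → Any (λ r → P r y) rs) m) → m ≡ just y →
                  ∃ λ i → colourOf q ≡ suc i × P (List.lookup rs i) y
  colourOf-just (just q) refl = Any.index q , refl , lookup-index q

module _ {c : Level} (𝕊 : Semiring c) where
  open Semiring 𝕊 renaming (_+_ to _+ₛ_)
  open IsCommutativeSemigroup +-isCommutativeSemigroup using () renaming (assoc to +-assoc; comm to +-comm)

  private
    _⊕_ : Maybe Carrier → Maybe Carrier → Maybe Carrier
    _⊕_ = _+?_ 𝕊
    Σ[_] : ∀ {n} → (Fin n → Carrier) → Subset n → Maybe Carrier
    Σ[_] = sumOver 𝕊

  ⊕-assoc : ∀ x y z → (x ⊕ y) ⊕ z ≡ x ⊕ (y ⊕ z)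
  ⊕-assoc nothing  _        _        = refl
  ⊕-assoc (just _) nothing  _        = refl
  ⊕-assoc (just _) (just _) nothing  = refl
  ⊕-assoc (just x) (just y) (just z) = cong just (+-assoc x y z)

  ⊕-comm : ∀ x y → x ⊕ y ≡ y ⊕ x
  ⊕-comm nothing  nothing  = refl
  ⊕-comm nothing  (just _) = refl
  ⊕-comm (just _) nothing  = refl
  ⊕-comm (just x) (just y) = cong just (+-comm x y)

  sumOver-⊥ : ∀ {n} (t : Fin n → Carrier) → Σ[ t ] ⊥ ≡ nothing
  sumOver-⊥ {zero}  t = refl
  sumOver-⊥ {suc n} t = sumOver-⊥ (t ∘ suc)

  sumOver-∪ : ∀ {n} (t : Fin n → Carrier) α β → Disjoint α β → Σ[ t ] (α ∪ β) ≡ Σ[ t ] α ⊕ Σ[ t ] β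
  sumOver-∪ t []            []            _   = refl
  sumOver-∪ t (inside ∷ α)  (inside ∷ β)  α#β = ⊥-elim (α#β here here)
  sumOver-∪ t (inside ∷ α)  (outside ∷ β) α#β =
    trans (cong (just (t zero) ⊕_) (sumOver-∪ (t ∘ suc) α β (λ x∈ x∈′ → α#β (there x∈) (there x∈′))))
          (sym (⊕-assoc (just (t zero)) (Σ[ t ∘ suc ] α) (Σ[ t ∘ suc ] β)))
  sumOver-∪ t (outside ∷ α) (inside ∷ β)  α#β = begin
    t₀ ⊕ Σ[ t ∘ suc ] (α ∪ β)  ≡⟨ cong (t₀ ⊕_) (sumOver-∪ (t ∘ suc) α β α#β′) ⟩
    t₀ ⊕ (Σα ⊕ Σβ)            ≡⟨ ⊕-assoc t₀ Σα Σβ ⟨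
    (t₀ ⊕ Σα) ⊕ Σβ            ≡⟨ cong (_⊕ Σβ) (⊕-comm t₀ Σα) ⟩
    (Σα ⊕ t₀) ⊕ Σβ            ≡⟨ ⊕-assoc Σα t₀ Σβ ⟩
    Σα ⊕ (t₀ ⊕ Σβ)            ∎
    where
    open ≡-Reasoning
    α#β′ : Disjoint α β
    α#β′ x∈ x∈′ = α#β (there x∈) (there x∈′)
    t₀ = just (t zero)
    Σα = Σ[ t ∘ suc ] α
    Σβ = Σ[ t ∘ suc ] β
  sumOver-∪ t (outside ∷ α) (outside ∷ β) α#β =
    sumOver-∪ (t ∘ suc) α β (λ x∈ x∈′ → α#β (there x∈) (there x∈′))

  sumOver-nonempty : ∀ {n} (t : Fin n → Carrier) α {y} → Σ[ t ] α ≡ just y → Nonempty α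
  sumOver-nonempty {suc n} t (inside ∷ α)  _  = zero , here
  sumOver-nonempty {suc n} t (outside ∷ α) eq =
    let x , x∈ = sumOver-nonempty (t ∘ suc) α eq in suc x , there x∈

  sumOver-map : (h : Carrier → Carrier) → (∀ x y → h (x +ₛ y) ≡ h x +ₛ h y) →
                ∀ {n} (s : Fin n → Carrier) β → Σ[ h ∘ s ] β ≡ Maybe.map h (Σ[ s ] β)
  sumOver-map h h-additive s []            = refl
  sumOver-map h h-additive s (outside ∷ β) = sumOver-map h h-additive (s ∘ suc) β
  sumOver-map h h-additive s (inside ∷ β)
    with Σ[ s ∘ suc ] β | sumOver-map h h-additive (s ∘ suc) β
  ... | nothing | eq = cong (just (h (s zero)) ⊕_) eq
  ... | just x  | eq = trans (cong (just (h (s zero)) ⊕_) eq) (cong just (sym (h-additive (s zero) x)))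

  sumOver-unionOf : ∀ {m n} (t : Fin n → Carrier) (D : Fin m → Subset n) →
                    (∀ {i j} → i ≢ j → Disjoint (D i) (D j)) →
                    (y : Fin m → Carrier) → (∀ j → Σ[ t ] (D j) ≡ just (y j)) →
                    ∀ β → Σ[ y ] β ≡ Σ[ t ] (unionOf D β)
  sumOver-unionOf t D D-disjoint y ΣD≡y []            = sym (sumOver-⊥ t)
  sumOver-unionOf t D D-disjoint y ΣD≡y (outside ∷ β) =
    sumOver-unionOf t (D ∘ suc) (D-disjoint ∘ (_∘ Fin.suc-injective)) (y ∘ suc) (ΣD≡y ∘ suc) β
  sumOver-unionOf t D D-disjoint y ΣD≡y (inside ∷ β)  = begin
    just (y zero) ⊕ Σ[ y ∘ suc ] β
      ≡⟨ cong₂ _⊕_ (sym (ΣD≡y zero))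
                   (sumOver-unionOf t (D ∘ suc) (D-disjoint ∘ (_∘ Fin.suc-injective)) (y ∘ suc) (ΣD≡y ∘ suc) β) ⟩
    Σ[ t ] (D zero) ⊕ Σ[ t ] (unionOf (D ∘ suc) β)
      ≡⟨ sumOver-∪ t (D zero) (unionOf (D ∘ suc) β) D₀#rest ⟨
    Σ[ t ] (D zero ∪ unionOf (D ∘ suc) β)
      ∎
    where
    open ≡-Reasoning
    D₀#rest : Disjoint (D zero) (unionOf (D ∘ suc) β)
    D₀#rest x∈D₀ x∈rest =
      let j , _ , x∈Dj = ∈-unionOf⁻ (D ∘ suc) β x∈rest in D-disjoint (λ ()) x∈D₀ x∈Dj

  IP-sums : ∀ {ℓ r} {B : Pred Carrier ℓ} (ip : IP 𝕊 r B) α → MaybeAll.All B (Σ[ proj₁ ip ] α)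
  IP-sums {B = B} (t , sums∈B) α with Σ[ t ] α in Σ≡y
  ... | nothing = nothing
  ... | just y  = let y′ , Σ≡y′ , y′∈B = sums∈B α (sumOver-nonempty t α Σ≡y)
                  in just (subst B (sym (just-injective (trans (sym Σ≡y) Σ≡y′))) y′∈B)

  -- One w works for all subset sums at once, since there are only finitely many of them.
  thick-absorbs-sums : ∀ {ℓ ℓ′ n} {R : Pred Carrier ℓ} {T : Pred Carrier ℓ′} → Thick 𝕊 R T →
                       (ip : IP 𝕊 n R) → ∃ λ w → ∀ α → MaybeAll.All (λ y → T (y · w)) (Σ[ proj₁ ip ] α)
  thick-absorbs-sums {n = n} thick ip =
    let w , _ , sums·w∈T = thick (mapMaybe Σ[ proj₁ ip ] (allSubsets n))
                                 (All.mapMaybe⁺ (All.map⁺ (All.universal (IP-sums ip) (allSubsets n))))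
    in w , λ α → All.lookup (All-mapMaybe⁻ (allSubsets n) sums·w∈T) (∈-allSubsets α)

  IP-blockImage : ∀ {ℓ ℓ′ n r} {B : Pred Carrier ℓ} {A : Pred Carrier ℓ′} (ip : IP 𝕊 n B) (D : Blocks r n)
                  (h : Carrier → Carrier) → (∀ x y → h (x +ₛ y) ≡ h x +ₛ h y) →
                  (∀ {β} → Nonempty β → ∀ {y} → Σ[ proj₁ ip ] (union D β) ≡ just y → A (h y)) → IP 𝕊 r A
  IP-blockImage {B = B} (t , sums) D h h-additive h[sums]∈A = h ∘ y , λ β β≠∅ →
    let x , Σ≡x , _ = sums (union D β) (union-nonempty D β≠∅)
    in h x , (begin
      Σ[ h ∘ y ] β                  ≡⟨ sumOver-map h h-additive y β ⟩
      Maybe.map h (Σ[ y ] β)        ≡⟨ cong (Maybe.map h) (sumOver-unionOf t (block D) (disjoint D) y Σblock≡y β) ⟩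
      Maybe.map h (Σ[ t ] (union D β)) ≡⟨ cong (Maybe.map h) Σ≡x ⟩
      just (h x)                    ∎) , h[sums]∈A β≠∅ Σ≡x
    where
    open ≡-Reasoning
    blockSum : ∀ j → ∃ λ x → Σ[ t ] (block D j) ≡ just x × B x
    blockSum j = sums (block D j) (nonempty D j)
    y : Fin _ → Carrier
    y = proj₁ ∘ blockSum
    Σblock≡y : ∀ j → Σ[ t ] (block D j) ≡ just (y j)
    Σblock≡y = proj₁ ∘ proj₂ ∘ blockSum

  ·-sandwich-additive : ∀ a b x y → a · ((x +ₛ y) · b) ≡ a · (x · b) +ₛ a · (y · b)
  ·-sandwich-additive a b x y = trans (cong (a ·_) (distribʳ b x y)) (distribˡ a (x · b) (y · b))

  IP-blockTranslates : ∀ {ℓ ℓ′ n r} {B : Pred Carrier ℓ} {A : Pred Carrier ℓ′}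
                       (ip : IP 𝕊 n B) (D : Blocks r n) (rs : List Carrier) (w : Carrier) (c : Fin (suc (length rs))) →
                       (∀ {β} → Nonempty β → ∀ {y} → Σ[ proj₁ ip ] (union D β) ≡ just y →
                                ∃ λ i → c ≡ suc i × A (List.lookup rs i · (y · w))) →
                       IP 𝕊 r A
  IP-blockTranslates ip D rs w zero    translates = IP-blockImage ip D id (λ _ _ → refl) λ β≠∅ Σ≡y →
    ⊥-elim (Fin.0≢1+n (proj₁ (proj₂ (translates β≠∅ Σ≡y))))
  IP-blockTranslates {A = A} ip D rs w (suc i) translates =
    IP-blockImage ip D (λ y → rᵢ · (y · w)) (·-sandwich-additive rᵢ w) λ {_} β≠∅ {y} Σ≡y →
      let _ , 1+i≡1+j , inA = translates β≠∅ Σ≡y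
      in subst (λ j → A (List.lookup rs j · (y · w))) (sym (Fin.suc-injective 1+i≡1+j)) inA
    where rᵢ = List.lookup rs i

theorem7p1 : {c ℓ₁ ℓ₂ : Level} (𝕊 : Semiring c) →
    (R : Pred (Semiring.Carrier 𝕊) ℓ₁) → IsSubsemigroup 𝕊 R → IP₀ 𝕊 R →
    (A : Pred (Semiring.Carrier 𝕊) ℓ₂) → A ⊆ R →
    PiecewiseSyndetic 𝕊 R A → IP₀ 𝕊 A
theorem7p1 𝕊 R _ R-IP₀ A _ (rs , _ , thick) r =
  IP-blockTranslates 𝕊 ip (blocks U) rs w c λ β≠∅ Σ≡y →
    let i , χ≡1+i , _ , inA = colourOf-just {P = λ r y → preimage 𝕊 R r A (y · w)} (cover _) Σ≡y
    in i , trans (sym (monochromatic U β≠∅)) χ≡1+i , inA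
  where
  open Semiring 𝕊 using (_·_)
  k = suc (length rs)
  n = proj₁ (folkman {k} r)
  ip = R-IP₀ n
  absorbed = thick-absorbs-sums 𝕊 {T = λ t → Any (λ r → preimage 𝕊 R r A t) rs} thick ip
  w = proj₁ absorbed
  cover = proj₂ absorbed
  -- α gets colour 0 if it is empty, and otherwise 1 + j for some j with rⱼ · ((Σ_{i∈α} tᵢ) · w) ∈ A.
  χ : Colouring k n
  χ α = colourOf (cover α)
  c = proj₁ (proj₂ (folkman r) χ)
  U = proj₂ (proj₂ (folkman r) χ)
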